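{- As graded $\mathfrak{S}_n$-modules, $\mathrm{NCHar}_n\simeq\mathbb{Q}\langle X_n\rangle/\langle\mathrm{NCSym}_n^+\rangle$.
   Context: $X_n=\{x_1,\dots,x_n\}$; $\mathbb{Q}\langle X_n\rangle$ is the free associative algebra, graded by degree, with $\mathfrak{S}_n$ acting by $\sigma(x_{i_1}\cdots x_{i_k})=x_{\sigma(i_1)}\cdots x_{\sigma(i_k)}$. For a set partition $A$ of $[m]$, $\mathbf{m}_A[X_n]=\sum x_{i_1}\cdots x_{i_m}$ over sequences in $[n]^m$ with $i_a=i_b$ iff $a,b$ lie in the same block of $A$; $\mathrm{NCSym}_n$ is their span (the $\mathfrak{S}_n$-invariants). $\langle\mathrm{NCSym}_n^+\rangle$ is the left ideal of $\mathbb{Q}\langle X_n\rangle$ generated by the elements of $\mathrm{NCSym}_n$ without constant term (spanned by $P\,\mathbf{m}_A[X_n]$, $P\in\mathbb{Q}\langle X_n\rangle$, $|A|\ge1$); it is $\mathfrak{S}_n$-stable. The twisted derivative $d_a$ satisfies $d_a(w)=w'$ if the word $w=aw'$ and $0$ otherwise; $f(d_{X_n})$ replaces each monomial $x_{i_1}\cdots x_{i_k}$ of $f$ by $d_{x_{i_1}}\cdots d_{x_{i_k}}$. $\mathrm{NCHar}_n=\{Q: f(d_{X_n})Q=0 \text{ for all } f\in\mathrm{NCSym}_n \text{ without constant term}\}$. -}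

module Defs where

open import Data.Nat as ℕ using (ℕ; zero; suc; _≡ᵇ_)
open import Data.Fin as Fin using (Fin)
open import Data.Fin.Permutation using (Permutation′; _⟨$⟩ʳ_)
open import Data.Bool using (Bool; true; false; _∧_; if_then_else_)
open import Data.Bool.Properties using () renaming (_≟_ to _≟𝔹_)
open import Data.List using (List; []; _∷_; _++_; map; concatMap; length; zip; allFin)
open import Data.List.Properties using (≡-dec)
open import Data.List.Relation.Unary.All using (All)
open import Data.Product using (_×_; _,_; Σ; ∃; proj₁; proj₂)
open import Data.Rational as ℚ using (ℚ; 0ℚ; 1ℚ)
open import Relation.Nullary using (does; ¬_)
open import Relation.Binary.PropositionalEquality using (_≡_)

Word : ℕ → Set
Word n = List (Fin n)

_≟w_ : ∀ {n} (u v : Word n) → Bool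
u ≟w v = does (≡-dec Fin._≟_ u v)

-- Q⟨X_n⟩ : a noncommutative polynomial is a formal finite ℚ-linear
-- combination of words; two are equal (≈) iff all coefficients agree.

NCPoly : ℕ → Set
NCPoly n = List (ℚ × Word n)

coeff : ∀ {n} → NCPoly n → Word n → ℚ
coeff []            w = 0ℚ
coeff ((c , u) ∷ p) w = (if u ≟w w then c else 0ℚ) ℚ.+ coeff p w

_≈_ : ∀ {n} → NCPoly n → NCPoly n → Set
p ≈ q = ∀ w → coeff p w ≡ coeff q w

zeroP : ∀ {n} → NCPoly n
zeroP = []

_⊕_ : ∀ {n} → NCPoly n → NCPoly n → NCPoly n
p ⊕ q = p ++ q

_·_ : ∀ {n} → ℚ → NCPoly n → NCPoly n
a · p = map (λ m → (a ℚ.* proj₁ m , proj₂ m)) p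

_⊖_ : ∀ {n} → NCPoly n → NCPoly n → NCPoly n
p ⊖ q = p ⊕ ((ℚ.- 1ℚ) · q)

_⊛_ : ∀ {n} → NCPoly n → NCPoly n → NCPoly n
p ⊛ q = concatMap (λ m → map (λ m' → (proj₁ m ℚ.* proj₁ m' , proj₂ m ++ proj₂ m')) q) p

Homogeneous : ∀ {n} → ℕ → NCPoly n → Set
Homogeneous d p = ∀ w → ¬ (length w ≡ d) → coeff p w ≡ 0ℚ

act : ∀ {n} → Permutation′ n → NCPoly n → NCPoly n
act σ p = map (λ m → (proj₁ m , map (σ ⟨$⟩ʳ_) (proj₂ m))) p

-- Set partitions A of [m] are encoded by a list of m block labels
-- (a, b in the same block iff their labels are equal).  |A| = m = length.

SetPartition : Set
SetPartition = List ℕ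

allWords : (n m : ℕ) → List (Word n)
allWords n zero    = [] ∷ []
allWords n (suc m) = concatMap (λ i → map (i ∷_) (allWords n m)) (allFin n)

allB : ∀ {A : Set} → (A → Bool) → List A → Bool
allB f []       = true
allB f (x ∷ xs) = f x ∧ allB f xs

-- i_a = i_b iff a, b in the same block, for all positions a, b
samePattern : ∀ {n} → List (Fin n × ℕ) → Bool
samePattern []            = true
samePattern ((x , k) ∷ r) =
  allB (λ yl → does ((does (x Fin.≟ proj₁ yl)) ≟𝔹 (k ≡ᵇ proj₂ yl))) r ∧ samePattern r

mA : (n : ℕ) → SetPartition → NCPoly n
mA n A = concatMap (λ w → if samePattern (zip w A) then (1ℚ , w) ∷ [] else [])
                   (allWords n (length A))

NonEmpty : SetPartition → Set
NonEmpty A = ¬ (A ≡ [])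

NCSymPlusElt : (n : ℕ) → List (ℚ × SetPartition) → NCPoly n
NCSymPlusElt n cs = concatMap (λ cA → proj₁ cA · mA n (proj₂ cA)) cs

InIdeal : ∀ {n} → NCPoly n → Set
InIdeal {n} p = Σ (List (NCPoly n × SetPartition)) λ gs →
  All (λ g → NonEmpty (proj₂ g)) gs ×
  p ≈ concatMap (λ g → proj₁ g ⊛ mA n (proj₂ g)) gs

_≈I_ : ∀ {n} → NCPoly n → NCPoly n → Set
p ≈I q = InIdeal (p ⊖ q)

dTw : ∀ {n} → Fin n → NCPoly n → NCPoly n
dTw a []                  = []
dTw a ((c , [])     ∷ p) = dTw a p
dTw a ((c , b ∷ u') ∷ p) = if does (a Fin.≟ b) then (c , u') ∷ dTw a p else dTw a p

-- d_{x_{i1}} ⋯ d_{x_{ik}} (composition; d_{x_{ik}} applied first)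
dWord : ∀ {n} → Word n → NCPoly n → NCPoly n
dWord []      Q = Q
dWord (i ∷ u) Q = dTw i (dWord u Q)

applyOp : ∀ {n} → NCPoly n → NCPoly n → NCPoly n
applyOp f Q = concatMap (λ m → proj₁ m · dWord (proj₂ m) Q) f

NCHar : ∀ {n} → NCPoly n → Set
NCHar {n} Q = ∀ (cs : List (ℚ × SetPartition)) → All (λ cA → NonEmpty (proj₂ cA)) cs →
  applyOp (NCSymPlusElt n cs) Q ≈ zeroP

HarDeg : (n d : ℕ) → NCPoly n → Set
HarDeg n d Q = Homogeneous d Q × NCHar Q

-- The quotient is
-- represented by homogeneous degree-d polynomials modulo ≈I.

record DegreeIso (n d : ℕ) : Set where
  field
    φ          : NCPoly n → NCPoly n
    φ-hom      : ∀ Q → HarDeg n d Q → Homogeneous d (φ Q)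
    φ-cong     : ∀ Q Q' → HarDeg n d Q → HarDeg n d Q' → Q ≈ Q' → φ Q ≈I φ Q'
    φ-linear   : ∀ (a b : ℚ) Q Q' → HarDeg n d Q → HarDeg n d Q' →
                 φ ((a · Q) ⊕ (b · Q')) ≈I ((a · φ Q) ⊕ (b · φ Q'))
    φ-equivar  : ∀ (σ : Permutation′ n) Q → HarDeg n d Q → φ (act σ Q) ≈I act σ (φ Q)
    φ-injective : ∀ Q → HarDeg n d Q → InIdeal (φ Q) → Q ≈ zeroP
    φ-surjective : ∀ P → Homogeneous d P → Σ (NCPoly n) λ Q → HarDeg n d Q × (P ≈I φ Q)

GradedIso : ℕ → Set
GradedIso n = ∀ (d : ℕ) → DegreeIso n d

{-# OPTIONS --safe #-}
module Submission where

-- The isomorphism is word reversal rev. Give the degree-d part of Q⟨X_n⟩ the inner product in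
-- which the words of length d are orthonormal. Twisted derivatives are adjoint to multiplication
-- up to reversal: the coefficient of v in f(d_X) Q is ⟨ rev(f) v , Q ⟩. So Q is harmonic exactly
-- when it is orthogonal to every rev(m_A) v, and since rev(P m_A) = rev(m_A) rev(P) these span the
-- reversal rev(I_d) of the degree-d part of the left ideal I = ⟨NCSym_n^+⟩: NCHar_d is the
-- orthogonal complement of rev(I_d). Gram–Schmidt against a finite spanning list of rev(I_d)
-- writes rev P = s + r with s ∈ rev(I_d) and r harmonic, so P ≡ rev r modulo I (surjectivity).
-- A harmonic Q with rev Q ∈ I_d is orthogonal to itself, so Q = 0 (injectivity). Reversal
-- commutes with the action of S_n on letters.

open import Defs
open import Data.Nat as ℕ using (ℕ; zero; suc; _≡ᵇ_)
import Data.Nat.Properties as ℕ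
open import Data.Fin as Fin using (Fin; toℕ)
open import Data.Fin.Permutation using (_⟨$⟩ʳ_)
open import Data.Fin.Properties using (toℕ-injective)
open import Data.Bool using (Bool; true; false; _∧_; if_then_else_)
open import Data.Bool.Properties using () renaming (_≟_ to _≟𝔹_)
open import Data.List using (List; []; _∷_; _++_; map; concatMap; length; reverse; allFin; zip)
open import Data.List.Properties
  using ( ≡-dec; ++-identityʳ; map-++; map-tabulate; concatMap-cong; concatMap-++; map-concatMap
        ; ʳ++-defn; reverse-involutive; reverse-map; reverse-++; length-++; length-reverse; length-map )
open import Data.List.Relation.Binary.Pointwise using (Pointwise; []; _∷_)
open import Data.List.Relation.Unary.All as All using (All; []; _∷_)
import Data.List.Relation.Unary.All.Properties as Allₚ
import Data.List.Relation.Unary.Any as Any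
open import Data.List.Relation.Unary.Any using (here; there)
open import Data.List.Membership.Propositional using (_∈_)
open import Data.List.Membership.Propositional.Properties using (∈-map⁺; ∈-concatMap⁺; ∈-allFin)
open import Data.Product using (_×_; _,_; ∃; proj₁; proj₂)
open import Data.Sum using (_⊎_; inj₁; inj₂)
open import Data.Rational as ℚ using (ℚ; 0ℚ; 1ℚ; _+_; _-_; _*_; -_; 1/_)
import Data.Rational.Properties as ℚ
open import Data.Rational.Solver using (module +-*-Solver)
open import Function using (_∘_; id; mk⇔)
open import Relation.Nullary using (does; ¬_; yes; no)
open import Relation.Nullary.Decidable using (dec-true; dec-false; does-⇔)
open import Relation.Binary.PropositionalEquality

open +-*-Solver using (solve; _:+_; _:-_; :-_; _:*_; _:=_; con)

∑ : {A : Set} → List A → (A → ℚ) → ℚ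
∑ []       f = 0ℚ
∑ (x ∷ xs) f = f x + ∑ xs f

syntax ∑ xs (λ x → e) = ∑[ x ∈ xs ] e

module _ {A : Set} where

  ∑-cong : ∀ (xs : List A) {f g : A → ℚ} → (∀ x → f x ≡ g x) → ∑ xs f ≡ ∑ xs g
  ∑-cong []       f≗g = refl
  ∑-cong (x ∷ xs) f≗g = cong₂ _+_ (f≗g x) (∑-cong xs f≗g)

  ∑-vanishes : ∀ {xs : List A} {f : A → ℚ} → All (λ x → f x ≡ 0ℚ) xs → ∑ xs f ≡ 0ℚ
  ∑-vanishes []           = refl
  ∑-vanishes (fx≡0 ∷ f≡0) = trans (cong₂ _+_ fx≡0 (∑-vanishes f≡0)) (ℚ.+-identityʳ 0ℚ)

  ∑-++ : ∀ (xs ys : List A) (f : A → ℚ) → ∑ (xs ++ ys) f ≡ ∑ xs f + ∑ ys f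
  ∑-++ []       ys f = sym (ℚ.+-identityˡ _)
  ∑-++ (x ∷ xs) ys f = trans (cong (f x +_) (∑-++ xs ys f)) (sym (ℚ.+-assoc (f x) _ _))

  ∑-distrib-+ : ∀ (xs : List A) (f g : A → ℚ) → ∑[ x ∈ xs ] (f x + g x) ≡ ∑ xs f + ∑ xs g
  ∑-distrib-+ []       f g = sym (ℚ.+-identityˡ 0ℚ)
  ∑-distrib-+ (x ∷ xs) f g =
    trans (cong (f x + g x +_) (∑-distrib-+ xs f g))
          (solve 4 (λ a b c d → (a :+ b) :+ (c :+ d) := (a :+ c) :+ (b :+ d)) refl (f x) (g x) (∑ xs f) (∑ xs g))

  *-distribˡ-∑ : ∀ (xs : List A) (a : ℚ) (f : A → ℚ) → a * ∑ xs f ≡ ∑[ x ∈ xs ] (a * f x)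
  *-distribˡ-∑ []       a f = ℚ.*-zeroʳ a
  *-distribˡ-∑ (x ∷ xs) a f = trans (ℚ.*-distribˡ-+ a (f x) _) (cong (a * f x +_) (*-distribˡ-∑ xs a f))

  ∑-map : ∀ {B : Set} (g : B → A) (ys : List B) (f : A → ℚ) → ∑ (map g ys) f ≡ ∑[ y ∈ ys ] f (g y)
  ∑-map g []       f = refl
  ∑-map g (y ∷ ys) f = cong (f (g y) +_) (∑-map g ys f)

  ∑-concatMap : ∀ {B : Set} (g : B → List A) (ys : List B) (f : A → ℚ) →
                ∑ (concatMap g ys) f ≡ ∑[ y ∈ ys ] ∑ (g y) f
  ∑-concatMap g []       f = refl
  ∑-concatMap g (y ∷ ys) f = trans (∑-++ (g y) (concatMap g ys) f) (cong (∑ (g y) f +_) (∑-concatMap g ys f))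

∑-allFin-suc : ∀ k (f : Fin (suc k) → ℚ) → ∑ (allFin (suc k)) f ≡ f Fin.zero + ∑[ i ∈ allFin k ] f (Fin.suc i)
∑-allFin-suc k f =
  cong (f Fin.zero +_) (trans (cong (λ is → ∑ is f) (sym (map-tabulate id Fin.suc))) (∑-map Fin.suc (allFin k) f))

∑-allFin-δ : ∀ {k} (j : Fin k) K → ∑[ i ∈ allFin k ] (if does (j Fin.≟ i) then K else 0ℚ) ≡ K
∑-allFin-δ {suc k} Fin.zero    K = trans (∑-allFin-suc k (λ i → if does (Fin.zero Fin.≟ i) then K else 0ℚ))
  (trans (cong (K +_) (∑-vanishes (All.universal (λ _ → refl) (allFin k)))) (ℚ.+-identityʳ K))
∑-allFin-δ {suc k} (Fin.suc j) K = trans (∑-allFin-suc k (λ i → if does (Fin.suc j Fin.≟ i) then K else 0ℚ))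
  (trans (ℚ.+-identityˡ _) (∑-allFin-δ j K))

0≤p*p : ∀ p → 0ℚ ℚ.≤ p * p
0≤p*p p with ℚ.≤-total 0ℚ p
... | inj₁ 0≤p = let instance _ = ℚ.nonNegative 0≤p in
  subst (ℚ._≤ p * p) (ℚ.*-zeroʳ p) (ℚ.*-monoˡ-≤-nonNeg p 0≤p)
... | inj₂ p≤0 = let instance _ = ℚ.nonPositive p≤0 in
  subst (ℚ._≤ p * p) (ℚ.*-zeroʳ p) (ℚ.*-monoˡ-≤-nonPos p p≤0)

p*p≡0⇒p≡0 : ∀ p → p * p ≡ 0ℚ → p ≡ 0ℚ
p*p≡0⇒p≡0 p p*p≡0 with p ℚ.≟ 0ℚ
... | yes p≡0 = p≡0
... | no  p≢0 = let instance _ = ℚ.≢-nonZero p≢0 in begin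
  p                ≡⟨ ℚ.*-identityˡ p ⟨
  1ℚ * p           ≡⟨ cong (_* p) (ℚ.*-inverseˡ p) ⟨
  (1/ p * p) * p   ≡⟨ ℚ.*-assoc (1/ p) p p ⟩
  1/ p * (p * p)   ≡⟨ cong (1/ p *_) p*p≡0 ⟩
  1/ p * 0ℚ        ≡⟨ ℚ.*-zeroʳ (1/ p) ⟩
  0ℚ               ∎
  where open ≡-Reasoning

x+y≡0⇒x≡0 : ∀ {x y} → 0ℚ ℚ.≤ x → 0ℚ ℚ.≤ y → x + y ≡ 0ℚ → x ≡ 0ℚ
x+y≡0⇒x≡0 {x} {y} 0≤x 0≤y x+y≡0 = ℚ.≤-antisym x≤0 0≤x
  where
  open ℚ.≤-Reasoning
  x≤0 : x ℚ.≤ 0ℚ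
  x≤0 = begin
    x      ≡⟨ ℚ.+-identityʳ x ⟨
    x + 0ℚ ≤⟨ ℚ.+-monoʳ-≤ x 0≤y ⟩
    x + y  ≡⟨ x+y≡0 ⟩
    0ℚ     ∎

module _ {A : Set} (f : A → ℚ) where

  ∑-squares-nonneg : ∀ xs → 0ℚ ℚ.≤ ∑[ x ∈ xs ] (f x * f x)
  ∑-squares-nonneg []       = ℚ.≤-refl
  ∑-squares-nonneg (x ∷ xs) = ℚ.+-mono-≤ (0≤p*p (f x)) (∑-squares-nonneg xs)

  ∑-squares≡0 : ∀ xs → ∑[ x ∈ xs ] (f x * f x) ≡ 0ℚ → All (λ x → f x ≡ 0ℚ) xs
  ∑-squares≡0 []       _   = []
  ∑-squares≡0 (x ∷ xs) ∑≡0 = p*p≡0⇒p≡0 (f x) head≡0 ∷ ∑-squares≡0 xs tail≡0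
    where
    head≡0 : f x * f x ≡ 0ℚ
    head≡0 = x+y≡0⇒x≡0 (0≤p*p (f x)) (∑-squares-nonneg xs) ∑≡0
    tail≡0 : ∑[ y ∈ xs ] (f y * f y) ≡ 0ℚ
    tail≡0 = trans (sym (ℚ.+-identityˡ _)) (trans (cong (_+ _) (sym head≡0)) ∑≡0)

*-if : ∀ a b x → a * (if b then x else 0ℚ) ≡ (if b then a * x else 0ℚ)
*-if a true  x = refl
*-if a false x = ℚ.*-zeroʳ a

∧≡true⁻ : ∀ {a b} → a ∧ b ≡ true → a ≡ true × b ≡ true
∧≡true⁻ {true} b≡true = refl , b≡true

≟𝔹≡true⁻ : ∀ {a b} → does (a ≟𝔹 b) ≡ true → a ≡ b
≟𝔹≡true⁻ {false} {false} _ = refl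
≟𝔹≡true⁻ {true}  {true}  _ = refl

toℕ-≡ᵇ : ∀ {k} (x y : Fin k) → (toℕ x ≡ᵇ toℕ y) ≡ does (x Fin.≟ y)
toℕ-≡ᵇ x y = does-⇔ (mk⇔ toℕ-injective (cong toℕ)) (toℕ x ℕ.≟ toℕ y) (x Fin.≟ y)

≢[]-by-length : ∀ {A B : Set} (xs : List A) (ys : List B) → length xs ≡ length ys → ¬ ys ≡ [] → ¬ xs ≡ []
≢[]-by-length []       []       _  ys≢[] _ = ys≢[] refl
≢[]-by-length []       (y ∷ ys) () _
≢[]-by-length (x ∷ xs) ys       _  _     ()

selected-or-none : ∀ {B C : Set} (p : B → Bool) (f : B → C) xs →
                   concatMap (λ x → if p x then f x ∷ [] else []) xs ≡ [] ⊎ ∃ λ x → x ∈ xs × p x ≡ true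
selected-or-none p f []       = inj₁ refl
selected-or-none p f (x ∷ xs) with p x in px≡b
... | true  = inj₂ (x , here refl , px≡b)
... | false with selected-or-none p f xs
...   | inj₁ none            = inj₁ none
...   | inj₂ (y , y∈xs , py) = inj₂ (y , there y∈xs , py)

module _ {n : ℕ} where

  ≈-sym : ∀ {p q : NCPoly n} → p ≈ q → q ≈ p
  ≈-sym p≈q w = sym (p≈q w)

  ≈-reflexive : ∀ {p q : NCPoly n} → p ≡ q → p ≈ q
  ≈-reflexive p≡q w = cong (λ r → coeff r w) p≡q

  coeff-⊕ : ∀ (p q : NCPoly n) w → coeff (p ⊕ q) w ≡ coeff p w + coeff q w
  coeff-⊕ []            q w = sym (ℚ.+-identityˡ _)
  coeff-⊕ ((c , u) ∷ p) q w =
    trans (cong (δ +_) (coeff-⊕ p q w)) (sym (ℚ.+-assoc δ (coeff p w) (coeff q w)))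
    where δ = if u ≟w w then c else 0ℚ

  coeff-· : ∀ a (p : NCPoly n) w → coeff (a · p) w ≡ a * coeff p w
  coeff-· a []            w = sym (ℚ.*-zeroʳ a)
  coeff-· a ((c , u) ∷ p) w =
    trans (cong₂ _+_ (sym (*-if a (u ≟w w) c)) (coeff-· a p w)) (sym (ℚ.*-distribˡ-+ a _ _))

  coeff-⊖ : ∀ (p q : NCPoly n) w → coeff (p ⊖ q) w ≡ coeff p w - coeff q w
  coeff-⊖ p q w = trans (coeff-⊕ p _ w) (cong (coeff p w +_) (trans (coeff-· (- 1ℚ) q w) -1*q≡-q))
    where
    -1*q≡-q : - 1ℚ * coeff q w ≡ - coeff q w
    -1*q≡-q = solve 1 (λ x → con (- 1ℚ) :* x := :- x) refl (coeff q w)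

  coeff-concatMap : ∀ {B : Set} (f : B → NCPoly n) xs w →
                    coeff (concatMap f xs) w ≡ ∑[ x ∈ xs ] coeff (f x) w
  coeff-concatMap f []       w = refl
  coeff-concatMap f (x ∷ xs) w = trans (coeff-⊕ (f x) _ w) (cong (coeff (f x) w +_) (coeff-concatMap f xs w))

  p⊖p≈0 : ∀ (p : NCPoly n) → (p ⊖ p) ≈ zeroP
  p⊖p≈0 p w = trans (coeff-⊖ p p w) (ℚ.+-inverseʳ (coeff p w))

  p⊖q⊕q≈p : ∀ (p q : NCPoly n) → ((p ⊖ q) ⊕ q) ≈ p
  p⊖q⊕q≈p p q w = begin
    coeff ((p ⊖ q) ⊕ q) w             ≡⟨ coeff-⊕ (p ⊖ q) q w ⟩
    coeff (p ⊖ q) w + coeff q w       ≡⟨ cong (_+ coeff q w) (coeff-⊖ p q w) ⟩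
    coeff p w - coeff q w + coeff q w ≡⟨ solve 2 (λ x y → x :- y :+ y := x) refl (coeff p w) (coeff q w) ⟩
    coeff p w                         ∎
    where open ≡-Reasoning

  p⊖[p⊖q]≈q : ∀ (p q : NCPoly n) → (p ⊖ (p ⊖ q)) ≈ q
  p⊖[p⊖q]≈q p q w = begin
    coeff (p ⊖ (p ⊖ q)) w               ≡⟨ coeff-⊖ p (p ⊖ q) w ⟩
    coeff p w - coeff (p ⊖ q) w         ≡⟨ cong (λ x → coeff p w - x) (coeff-⊖ p q w) ⟩
    coeff p w - (coeff p w - coeff q w) ≡⟨ solve 2 (λ x y → x :- (x :- y) := y) refl (coeff p w) (coeff q w) ⟩
    coeff q w                           ∎
    where open ≡-Reasoning

  p⊖[q⊖r]≈p⊖q⊕r : ∀ (p q r : NCPoly n) → (p ⊖ (q ⊖ r)) ≈ ((p ⊖ q) ⊕ r)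
  p⊖[q⊖r]≈p⊖q⊕r p q r w = begin
    coeff (p ⊖ (q ⊖ r)) w               ≡⟨ coeff-⊖ p (q ⊖ r) w ⟩
    coeff p w - coeff (q ⊖ r) w         ≡⟨ cong (λ x → coeff p w - x) (coeff-⊖ q r w) ⟩
    coeff p w - (coeff q w - coeff r w) ≡⟨ solve 3 (λ x y z → x :- (y :- z) := x :- y :+ z) refl
                                                   (coeff p w) (coeff q w) (coeff r w) ⟩
    coeff p w - coeff q w + coeff r w   ≡⟨ cong (_+ coeff r w) (coeff-⊖ p q w) ⟨
    coeff (p ⊖ q) w + coeff r w         ≡⟨ coeff-⊕ (p ⊖ q) r w ⟨
    coeff ((p ⊖ q) ⊕ r) w               ∎
    where open ≡-Reasoning

  coeff-⊛-·ˡ : ∀ a (P q : NCPoly n) w → coeff ((a · P) ⊛ q) w ≡ a * coeff (P ⊛ q) w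
  coeff-⊛-·ˡ a []            q w = sym (ℚ.*-zeroʳ a)
  coeff-⊛-·ˡ a ((c , u) ∷ P) q w =
    trans (coeff-⊕ (row (a * c) q) ((a · P) ⊛ q) w)
          (trans (cong₂ _+_ (coeff-row q) (coeff-⊛-·ˡ a P q w))
                 (trans (sym (ℚ.*-distribˡ-+ a _ _)) (cong (a *_) (sym (coeff-⊕ (row c q) (P ⊛ q) w)))))
    where
    row : ℚ → NCPoly n → NCPoly n
    row c′ r = map (λ m → c′ * proj₁ m , u ++ proj₂ m) r
    coeff-row : ∀ r → coeff (row (a * c) r) w ≡ a * coeff (row c r) w
    coeff-row []             = sym (ℚ.*-zeroʳ a)
    coeff-row ((c′ , v) ∷ r) = trans
      (cong₂ _+_ (trans (cong (λ x → if (u ++ v) ≟w w then x else 0ℚ) (ℚ.*-assoc a c c′))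
                        (sym (*-if a _ (c * c′))))
                 (coeff-row r))
      (sym (ℚ.*-distribˡ-+ a _ _))

  allWords-length : ∀ m → All (λ w → length w ≡ m) (allWords n m)
  allWords-length zero    = refl ∷ []
  allWords-length (suc m) =
    Allₚ.concat⁺ (Allₚ.map⁺ (All.universal (λ i → Allₚ.map⁺ (All.map (cong suc) (allWords-length m)))
                                           (allFin n)))

  ∈-allWords : ∀ (w : Word n) → w ∈ allWords n (length w)
  ∈-allWords []      = here refl
  ∈-allWords (i ∷ w) = ∈-concatMap⁺ (λ j → map (j ∷_) (allWords n (length w)))
                                    (Any.map (λ { refl → ∈-map⁺ (i ∷_) (∈-allWords w) }) (∈-allFin i))

  ∑-allWords-δ : ∀ m (u : Word n) c (f : Word n → ℚ) → (¬ length u ≡ m → f u ≡ 0ℚ) →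
                 ∑[ w ∈ allWords n m ] ((if u ≟w w then c else 0ℚ) * f w) ≡ c * f u
  ∑-allWords-δ zero    []      c f off = ℚ.+-identityʳ _
  ∑-allWords-δ zero    (i ∷ u) c f off =
    trans (ℚ.+-identityʳ (0ℚ * f []))
          (trans (ℚ.*-zeroˡ (f [])) (sym (trans (cong (c *_) (off λ ())) (ℚ.*-zeroʳ c))))
  ∑-allWords-δ (suc m) u c f off =
    trans (∑-concatMap (λ i → map (i ∷_) (allWords n m)) (allFin n) term)
          (trans (∑-cong (allFin n) (λ i → ∑-map (i ∷_) (allWords n m) term)) (by-first-letter u off))
    where
    term : Word n → ℚ
    term w = (if u ≟w w then c else 0ℚ) * f w
    by-first-letter : ∀ u → (¬ length u ≡ suc m → f u ≡ 0ℚ) →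
      ∑[ i ∈ allFin n ] ∑[ w ∈ allWords n m ] ((if u ≟w (i ∷ w) then c else 0ℚ) * f (i ∷ w)) ≡ c * f u
    by-first-letter []      off = trans
      (∑-vanishes (All.universal (λ i → ∑-vanishes (All.universal (λ w → ℚ.*-zeroˡ (f (i ∷ w))) (allWords n m)))
                                 (allFin n)))
      (sym (trans (cong (c *_) (off λ ())) (ℚ.*-zeroʳ c)))
    by-first-letter (j ∷ u) off = trans (∑-cong (allFin n) row) (∑-allFin-δ j (c * f (j ∷ u)))
      where
      row : ∀ i → ∑[ w ∈ allWords n m ] ((if does (j Fin.≟ i) ∧ (u ≟w w) then c else 0ℚ) * f (i ∷ w))
                ≡ (if does (j Fin.≟ i) then c * f (j ∷ u) else 0ℚ)
      row i with j Fin.≟ i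
      ... | yes refl = ∑-allWords-δ m u c (f ∘ (j ∷_)) (λ |u|≢m → off (|u|≢m ∘ ℕ.suc-injective))
      ... | no  _    = ∑-vanishes (All.universal (λ w → ℚ.*-zeroˡ (f (i ∷ w))) (allWords n m))

  homogeneous-by-lengths : ∀ {k} (p : NCPoly n) → All (λ m → length (proj₂ m) ≡ k) p → Homogeneous k p
  homogeneous-by-lengths []            []               w |w|≢k = refl
  homogeneous-by-lengths ((c , u) ∷ p) (|u|≡k ∷ |p|≡k) w |w|≢k =
    trans (cong₂ _+_ (cong (λ b → if b then c else 0ℚ) u≢w) (homogeneous-by-lengths p |p|≡k w |w|≢k))
          (ℚ.+-identityʳ 0ℚ)
    where
    u≢w : (u ≟w w) ≡ false
    u≢w = dec-false (≡-dec Fin._≟_ u w) (λ u≡w → |w|≢k (trans (cong length (sym u≡w)) |u|≡k))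

-- Spans, subspaces and Gram–Schmidt

module _ {n : ℕ} where

  data Span (G : List (NCPoly n)) : NCPoly n → Set where
    span-gen  : ∀ {g} → g ∈ G → Span G g
    span-zero : Span G zeroP
    span-⊕    : ∀ {p q} → Span G p → Span G q → Span G (p ⊕ q)
    span-·    : ∀ a {p} → Span G p → Span G (a · p)
    span-≈    : ∀ {p q} → p ≈ q → Span G p → Span G q

  record IsSubspace (S : NCPoly n → Set) : Set where
    field
      zero-closed : S zeroP
      ⊕-closed    : ∀ {p q} → S p → S q → S (p ⊕ q)
      ·-closed    : ∀ a {p} → S p → S (a · p)
      ≈-closed    : ∀ {p q} → p ≈ q → S p → S q

    ⊖-closed : ∀ {p q} → S p → S q → S (p ⊖ q)
    ⊖-closed Sp Sq = ⊕-closed Sp (·-closed (- 1ℚ) Sq)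

  Span-isSubspace : ∀ G → IsSubspace (Span G)
  Span-isSubspace G = record
    { zero-closed = span-zero ; ⊕-closed = span-⊕ ; ·-closed = span-· ; ≈-closed = span-≈ }

  Span-least : ∀ {S G p} → IsSubspace S → All S G → Span G p → S p
  Span-least S-sub S-G (span-gen g∈G) = All.lookup S-G g∈G
  Span-least S-sub S-G span-zero      = IsSubspace.zero-closed S-sub
  Span-least S-sub S-G (span-⊕ x y)   = IsSubspace.⊕-closed S-sub (Span-least S-sub S-G x) (Span-least S-sub S-G y)
  Span-least S-sub S-G (span-· a x)   = IsSubspace.·-closed S-sub a (Span-least S-sub S-G x)
  Span-least S-sub S-G (span-≈ e x)   = IsSubspace.≈-closed S-sub e (Span-least S-sub S-G x)

  Span-∷ : ∀ {g G p} → Span G p → Span (g ∷ G) p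
  Span-∷ {g} {G} = Span-least (Span-isSubspace (g ∷ G)) (All.tabulate (λ g′∈G → span-gen (there g′∈G)))

  Homogeneous-isSubspace : ∀ d → IsSubspace (Homogeneous d)
  Homogeneous-isSubspace d = record
    { zero-closed = λ w _ → refl
    ; ⊕-closed    = λ {p} {q} hom-p hom-q w |w|≢d →
        trans (coeff-⊕ p q w) (trans (cong₂ _+_ (hom-p w |w|≢d) (hom-q w |w|≢d)) (ℚ.+-identityʳ 0ℚ))
    ; ·-closed    = λ a {p} hom-p w |w|≢d →
        trans (coeff-· a p w) (trans (cong (a *_) (hom-p w |w|≢d)) (ℚ.*-zeroʳ a))
    ; ≈-closed    = λ p≈q hom-p w |w|≢d → trans (sym (p≈q w)) (hom-p w |w|≢d)
    }

  module InnerProduct (ws : List (Word n)) where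

    ⟨_,_⟩ : NCPoly n → NCPoly n → ℚ
    ⟨ p , q ⟩ = ∑[ w ∈ ws ] (coeff p w * coeff q w)

    ⟨⟩-sym : ∀ p q → ⟨ p , q ⟩ ≡ ⟨ q , p ⟩
    ⟨⟩-sym p q = ∑-cong ws (λ w → ℚ.*-comm (coeff p w) (coeff q w))

    ⟨⟩-congʳ : ∀ r {p q} → p ≈ q → ⟨ r , p ⟩ ≡ ⟨ r , q ⟩
    ⟨⟩-congʳ r p≈q = ∑-cong ws (λ w → cong (coeff r w *_) (p≈q w))

    ⟨⟩-congˡ : ∀ r {p q} → p ≈ q → ⟨ p , r ⟩ ≡ ⟨ q , r ⟩
    ⟨⟩-congˡ r p≈q = ∑-cong ws (λ w → cong (_* coeff r w) (p≈q w))

    ⟨⟩-zeroʳ : ∀ r → ⟨ r , zeroP ⟩ ≡ 0ℚ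
    ⟨⟩-zeroʳ r = ∑-vanishes (All.universal (λ w → ℚ.*-zeroʳ (coeff r w)) ws)

    ⟨⟩-⊕ʳ : ∀ r p q → ⟨ r , p ⊕ q ⟩ ≡ ⟨ r , p ⟩ + ⟨ r , q ⟩
    ⟨⟩-⊕ʳ r p q = trans (∑-cong ws distrib) (∑-distrib-+ ws _ _)
      where
      distrib : ∀ w → coeff r w * coeff (p ⊕ q) w ≡ coeff r w * coeff p w + coeff r w * coeff q w
      distrib w = trans (cong (coeff r w *_) (coeff-⊕ p q w)) (ℚ.*-distribˡ-+ (coeff r w) _ _)

    ⟨⟩-·ʳ : ∀ r a p → ⟨ r , a · p ⟩ ≡ a * ⟨ r , p ⟩
    ⟨⟩-·ʳ r a p = trans (∑-cong ws commute) (sym (*-distribˡ-∑ ws a _))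
      where
      commute : ∀ w → coeff r w * coeff (a · p) w ≡ a * (coeff r w * coeff p w)
      commute w = trans (cong (coeff r w *_) (coeff-· a p w))
                        (solve 3 (λ x y z → x :* (y :* z) := y :* (x :* z)) refl (coeff r w) a (coeff p w))

    ⟨⟩-⊖·ˡ : ∀ p a q x → ⟨ p ⊖ (a · q) , x ⟩ ≡ ⟨ p , x ⟩ - a * ⟨ q , x ⟩
    ⟨⟩-⊖·ˡ p a q x = begin
      ⟨ p ⊖ (a · q) , x ⟩           ≡⟨ ∑-cong ws expand ⟩
      ∑[ w ∈ ws ] (coeff p w * coeff x w + - a * (coeff q w * coeff x w))
                                    ≡⟨ ∑-distrib-+ ws _ _ ⟩
      ⟨ p , x ⟩ + ∑[ w ∈ ws ] (- a * (coeff q w * coeff x w))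
                                    ≡⟨ cong (⟨ p , x ⟩ +_) (*-distribˡ-∑ ws (- a) _) ⟨
      ⟨ p , x ⟩ + - a * ⟨ q , x ⟩   ≡⟨ cong (⟨ p , x ⟩ +_) (ℚ.neg-distribˡ-* a _) ⟨
      ⟨ p , x ⟩ - a * ⟨ q , x ⟩     ∎
      where
      open ≡-Reasoning
      expand : ∀ w → coeff (p ⊖ (a · q)) w * coeff x w ≡ coeff p w * coeff x w + - a * (coeff q w * coeff x w)
      expand w = trans (cong (_* coeff x w) (trans (coeff-⊖ p (a · q) w) (cong (λ y → coeff p w - y) (coeff-· a q w))))
                       (solve 4 (λ u a v y → (u :- a :* v) :* y := u :* y :+ (:- a) :* (v :* y)) refl
                              (coeff p w) a (coeff q w) (coeff x w))

    _⟂_ : NCPoly n → List (NCPoly n) → Set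
    r ⟂ G = All (λ g → ⟨ r , g ⟩ ≡ 0ℚ) G

    ⟂-isSubspace : ∀ r → IsSubspace (λ s → ⟨ r , s ⟩ ≡ 0ℚ)
    ⟂-isSubspace r = record
      { zero-closed = ⟨⟩-zeroʳ r
      ; ⊕-closed    = λ {p} {q} r⟂p r⟂q → trans (⟨⟩-⊕ʳ r p q) (cong₂ _+_ r⟂p r⟂q)
      ; ·-closed    = λ a {p} r⟂p → trans (⟨⟩-·ʳ r a p) (trans (cong (a *_) r⟂p) (ℚ.*-zeroʳ a))
      ; ≈-closed    = λ {p} {q} p≈q r⟂p → trans (sym (⟨⟩-congʳ r {p} {q} p≈q)) r⟂p
      }

    ⟂-Span : ∀ r {G s} → r ⟂ G → Span G s → ⟨ r , s ⟩ ≡ 0ℚ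
    ⟂-Span r = Span-least (⟂-isSubspace r)

    isotropic⇒vanishes : ∀ h → ⟨ h , h ⟩ ≡ 0ℚ → All (λ w → coeff h w ≡ 0ℚ) ws
    isotropic⇒vanishes h = ∑-squares≡0 (coeff h) ws

    isotropic⇒orthogonal : ∀ h → ⟨ h , h ⟩ ≡ 0ℚ → ∀ x → ⟨ x , h ⟩ ≡ 0ℚ
    isotropic⇒orthogonal h ⟨h,h⟩≡0 x =
      ∑-vanishes (All.map (λ {w} hw≡0 → trans (cong (coeff x w *_) hw≡0) (ℚ.*-zeroʳ (coeff x w)))
                          (isotropic⇒vanishes h ⟨h,h⟩≡0))

    ⟨x,h⟩-multiple-of-⟨h,h⟩ : ∀ x h → ∃ λ c → ⟨ x , h ⟩ ≡ c * ⟨ h , h ⟩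
    ⟨x,h⟩-multiple-of-⟨h,h⟩ x h with ⟨ h , h ⟩ ℚ.≟ 0ℚ
    ... | yes ⟨h,h⟩≡0 = 0ℚ , trans (isotropic⇒orthogonal h ⟨h,h⟩≡0 x) (sym (ℚ.*-zeroˡ ⟨ h , h ⟩))
    ... | no  ⟨h,h⟩≢0 = ⟨ x , h ⟩ * 1/ ⟨ h , h ⟩ , sym (begin
      (⟨ x , h ⟩ * 1/ ⟨ h , h ⟩) * ⟨ h , h ⟩ ≡⟨ ℚ.*-assoc ⟨ x , h ⟩ _ _ ⟩
      ⟨ x , h ⟩ * (1/ ⟨ h , h ⟩ * ⟨ h , h ⟩) ≡⟨ cong (⟨ x , h ⟩ *_) (ℚ.*-inverseˡ ⟨ h , h ⟩) ⟩
      ⟨ x , h ⟩ * 1ℚ                         ≡⟨ ℚ.*-identityʳ ⟨ x , h ⟩ ⟩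
      ⟨ x , h ⟩                              ∎)
      where
      open ≡-Reasoning
      instance _ = ℚ.≢-nonZero ⟨h,h⟩≢0

    orthogonal-decomposition : ∀ G P → ∃ λ r → Span G (P ⊖ r) × r ⟂ G
    orthogonal-decomposition []      P = P , span-≈ {p = zeroP} (≈-sym {p = P ⊖ P} {zeroP} (p⊖p≈0 P)) span-zero , []
    orthogonal-decomposition (g ∷ G) P
      with orthogonal-decomposition G g | orthogonal-decomposition G P
    ... | h , g⊖h∈G , h⟂G | r₀ , P⊖r₀∈G , r₀⟂G
      with ⟨x,h⟩-multiple-of-⟨h,h⟩ r₀ h
    ... | c , ⟨r₀,h⟩≡c⟨h,h⟩ = r , P⊖r∈g∷G , ⟨r,g⟩≡0 ∷ r⟂G
      where
      open IsSubspace (Span-isSubspace (g ∷ G))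
      r : NCPoly n
      r = r₀ ⊖ (c · h)

      h∈g∷G : Span (g ∷ G) h
      h∈g∷G = ≈-closed {g ⊖ (g ⊖ h)} (p⊖[p⊖q]≈q g h) (⊖-closed (span-gen (here refl)) (Span-∷ g⊖h∈G))

      P⊖r∈g∷G : Span (g ∷ G) (P ⊖ r)
      P⊖r∈g∷G = ≈-closed {(P ⊖ r₀) ⊕ (c · h)}
                         (≈-sym {p = P ⊖ r} {(P ⊖ r₀) ⊕ (c · h)} (p⊖[q⊖r]≈p⊖q⊕r P r₀ (c · h)))
                         (⊕-closed (Span-∷ P⊖r₀∈G) (·-closed c h∈g∷G))

      r⟂G : r ⟂ G
      r⟂G = All.zipWith (λ {g′} (⟨r₀,g′⟩≡0 , ⟨h,g′⟩≡0) → trans (⟨⟩-⊖·ˡ r₀ c h g′)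
              (trans (cong₂ (λ x y → x - c * y) ⟨r₀,g′⟩≡0 ⟨h,g′⟩≡0)
                     (solve 1 (λ c → con 0ℚ :- c :* con 0ℚ := con 0ℚ) refl c)))
              (r₀⟂G , h⟂G)

      ⟨r,h⟩≡0 : ⟨ r , h ⟩ ≡ 0ℚ
      ⟨r,h⟩≡0 = trans (⟨⟩-⊖·ˡ r₀ c h h)
                  (trans (cong (_- c * ⟨ h , h ⟩) ⟨r₀,h⟩≡c⟨h,h⟩) (ℚ.+-inverseʳ (c * ⟨ h , h ⟩)))

      ⟨r,g⟩≡0 : ⟨ r , g ⟩ ≡ 0ℚ
      ⟨r,g⟩≡0 = begin
        ⟨ r , g ⟩                  ≡⟨ ⟨⟩-congʳ r {(g ⊖ h) ⊕ h} {g} (p⊖q⊕q≈p g h) ⟨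
        ⟨ r , (g ⊖ h) ⊕ h ⟩        ≡⟨ ⟨⟩-⊕ʳ r (g ⊖ h) h ⟩
        ⟨ r , g ⊖ h ⟩ + ⟨ r , h ⟩  ≡⟨ cong₂ _+_ (⟂-Span r r⟂G g⊖h∈G) ⟨r,h⟩≡0 ⟩
        0ℚ + 0ℚ                    ≡⟨ ℚ.+-identityʳ 0ℚ ⟩
        0ℚ                         ∎
        where open ≡-Reasoning

-- Twisted derivatives as adjoints

module _ {n : ℕ} where

  pairing : NCPoly n → NCPoly n → ℚ
  pairing x Q = ∑[ m ∈ x ] (proj₁ m * coeff Q (proj₂ m))

  revMul : NCPoly n → Word n → NCPoly n
  revMul f v = map (λ m → proj₁ m , reverse (proj₂ m) ++ v) f

  pairing-revMul : ∀ f v Q → pairing (revMul f v) Q ≡ ∑[ m ∈ f ] (proj₁ m * coeff Q (reverse (proj₂ m) ++ v))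
  pairing-revMul f v Q = ∑-map _ f _

  pairing-off-degree : ∀ {d} Q (x : NCPoly n) → Homogeneous d Q → All (λ m → ¬ length (proj₂ m) ≡ d) x →
                       pairing x Q ≡ 0ℚ
  pairing-off-degree Q x hom off = ∑-vanishes (All.map (λ {m} |m|≢d →
    trans (cong (proj₁ m *_) (hom (proj₂ m) |m|≢d)) (ℚ.*-zeroʳ (proj₁ m))) off)

  ⟨⟩≡pairing : ∀ d x Q → Homogeneous d Q → InnerProduct.⟨_,_⟩ (allWords n d) x Q ≡ pairing x Q
  ⟨⟩≡pairing d []            Q hom = ∑-vanishes (All.universal (λ w → ℚ.*-zeroˡ (coeff Q w)) (allWords n d))
  ⟨⟩≡pairing d ((c , u) ∷ x) Q hom = begin
    ∑[ w ∈ allWords n d ] ((δ w + coeff x w) * coeff Q w)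
      ≡⟨ ∑-cong (allWords n d) (λ w → ℚ.*-distribʳ-+ (coeff Q w) (δ w) (coeff x w)) ⟩
    ∑[ w ∈ allWords n d ] (δ w * coeff Q w + coeff x w * coeff Q w)
      ≡⟨ ∑-distrib-+ (allWords n d) (λ w → δ w * coeff Q w) (λ w → coeff x w * coeff Q w) ⟩
    ∑[ w ∈ allWords n d ] (δ w * coeff Q w) + InnerProduct.⟨_,_⟩ (allWords n d) x Q
      ≡⟨ cong₂ _+_ (∑-allWords-δ d u c (coeff Q) (hom u)) (⟨⟩≡pairing d x Q hom) ⟩
    c * coeff Q u + pairing x Q
      ∎
    where
    open ≡-Reasoning
    δ : Word n → ℚ
    δ w = if u ≟w w then c else 0ℚ

  revMul-lengths : ∀ {k} (f : NCPoly n) (v : Word n) → All (λ m → length (proj₂ m) ≡ k) f →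
                   All (λ m → length (proj₂ m) ≡ k ℕ.+ length v) (revMul f v)
  revMul-lengths {k} f v |f|≡k = Allₚ.map⁺ (All.map (λ {m} |m|≡k → begin
    length (reverse (proj₂ m) ++ v)         ≡⟨ length-++ (reverse (proj₂ m)) ⟩
    length (reverse (proj₂ m)) ℕ.+ length v ≡⟨ cong (ℕ._+ length v) (trans (length-reverse (proj₂ m)) |m|≡k) ⟩
    k ℕ.+ length v                          ∎) |f|≡k)
    where open ≡-Reasoning

  coeff-dTw : ∀ a (p : NCPoly n) w → coeff (dTw a p) w ≡ coeff p (a ∷ w)
  coeff-dTw a []                w = refl
  coeff-dTw a ((c , [])    ∷ p) w = trans (coeff-dTw a p w) (sym (ℚ.+-identityˡ _))
  coeff-dTw a ((c , b ∷ u) ∷ p) w with a Fin.≟ b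
  ... | yes refl = cong₂ _+_ (cong (λ t → if t ∧ (u ≟w w) then c else 0ℚ) (sym (dec-true (a Fin.≟ a) refl)))
                             (coeff-dTw a p w)
  ... | no  a≢b  = trans (coeff-dTw a p w) (sym (trans (cong (λ t → (if t ∧ (u ≟w w) then c else 0ℚ) + coeff p (a ∷ w))
                                                            (dec-false (b Fin.≟ a) (a≢b ∘ sym)))
                                                      (ℚ.+-identityˡ _)))

  coeff-dWord : ∀ (u : Word n) Q w → coeff (dWord u Q) w ≡ coeff Q (reverse u ++ w)
  coeff-dWord []      Q w = refl
  coeff-dWord (i ∷ u) Q w = trans (coeff-dTw i (dWord u Q) w)
    (trans (coeff-dWord u Q (i ∷ w)) (cong (coeff Q) (trans (sym (ʳ++-defn u)) (ʳ++-defn (i ∷ u)))))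

  coeff-applyOp : ∀ f Q w → coeff (applyOp f Q) w ≡ pairing (revMul f w) Q
  coeff-applyOp f Q w = trans (coeff-concatMap _ f w) (trans (∑-cong f term) (sym (pairing-revMul f w Q)))
    where
    term : ∀ m → coeff (proj₁ m · dWord (proj₂ m) Q) w ≡ proj₁ m * coeff Q (reverse (proj₂ m) ++ w)
    term (c , u) = trans (coeff-· c (dWord u Q) w) (cong (c *_) (coeff-dWord u Q w))

  pairing-revMul-· : ∀ a f v Q → pairing (revMul (a · f) v) Q ≡ a * pairing (revMul f v) Q
  pairing-revMul-· a f v Q = begin
    pairing (revMul (a · f) v) Q
      ≡⟨ pairing-revMul (a · f) v Q ⟩
    ∑[ m ∈ a · f ] (proj₁ m * coeff Q (reverse (proj₂ m) ++ v))
      ≡⟨ ∑-map _ f _ ⟩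
    ∑[ m ∈ f ] ((a * proj₁ m) * coeff Q (reverse (proj₂ m) ++ v))
      ≡⟨ ∑-cong f (λ m → ℚ.*-assoc a (proj₁ m) _) ⟩
    ∑[ m ∈ f ] (a * (proj₁ m * coeff Q (reverse (proj₂ m) ++ v)))
      ≡⟨ *-distribˡ-∑ f a _ ⟨
    a * ∑[ m ∈ f ] (proj₁ m * coeff Q (reverse (proj₂ m) ++ v))
      ≡⟨ cong (a *_) (pairing-revMul f v Q) ⟨
    a * pairing (revMul f v) Q
      ∎
    where open ≡-Reasoning

  coeff-applyOp-NCSymPlusElt : ∀ cs Q w →
    coeff (applyOp (NCSymPlusElt n cs) Q) w ≡ ∑[ cA ∈ cs ] (proj₁ cA * pairing (revMul (mA n (proj₂ cA)) w) Q)
  coeff-applyOp-NCSymPlusElt cs Q w = begin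
    coeff (applyOp (NCSymPlusElt n cs) Q) w
      ≡⟨ coeff-applyOp (NCSymPlusElt n cs) Q w ⟩
    pairing (revMul (NCSymPlusElt n cs) w) Q
      ≡⟨ pairing-revMul (NCSymPlusElt n cs) w Q ⟩
    ∑[ m ∈ NCSymPlusElt n cs ] (proj₁ m * coeff Q (reverse (proj₂ m) ++ w))
      ≡⟨ ∑-concatMap _ cs _ ⟩
    ∑[ cA ∈ cs ] ∑[ m ∈ proj₁ cA · mA n (proj₂ cA) ] (proj₁ m * coeff Q (reverse (proj₂ m) ++ w))
      ≡⟨ ∑-cong cs (λ (c , A) → trans (sym (pairing-revMul (c · mA n A) w Q)) (pairing-revMul-· c (mA n A) w Q)) ⟩
    ∑[ cA ∈ cs ] (proj₁ cA * pairing (revMul (mA n (proj₂ cA)) w) Q)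
      ∎
    where open ≡-Reasoning

  AnnihilatedByNCSym⁺ : NCPoly n → Set
  AnnihilatedByNCSym⁺ Q = ∀ A → NonEmpty A → ∀ w → pairing (revMul (mA n A) w) Q ≡ 0ℚ

  NCHar⇒annihilated : ∀ {Q} → NCHar Q → AnnihilatedByNCSym⁺ Q
  NCHar⇒annihilated {Q} harmonic A A≢[] w = begin
    pairing (revMul (mA n A) w) Q            ≡⟨ ℚ.*-identityˡ _ ⟨
    1ℚ * pairing (revMul (mA n A) w) Q       ≡⟨ ℚ.+-identityʳ _ ⟨
    ∑[ cA ∈ (1ℚ , A) ∷ [] ] (proj₁ cA * pairing (revMul (mA n (proj₂ cA)) w) Q)
                                             ≡⟨ coeff-applyOp-NCSymPlusElt ((1ℚ , A) ∷ []) Q w ⟨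
    coeff (applyOp (NCSymPlusElt n ((1ℚ , A) ∷ [])) Q) w
                                             ≡⟨ harmonic ((1ℚ , A) ∷ []) (A≢[] ∷ []) w ⟩
    0ℚ                                       ∎
    where open ≡-Reasoning

  annihilated⇒NCHar : ∀ {Q} → AnnihilatedByNCSym⁺ Q → NCHar Q
  annihilated⇒NCHar {Q} annihilated cs cs≢[] w =
    trans (coeff-applyOp-NCSymPlusElt cs Q w)
          (∑-vanishes (All.map (λ {cA} A≢[] → trans (cong (proj₁ cA *_) (annihilated (proj₂ cA) A≢[] w))
                                                    (ℚ.*-zeroʳ (proj₁ cA)))
                               cs≢[]))

infix 4 _≋_

SameEquality : ℕ → ℕ → ℕ → ℕ → Set
SameEquality a b a′ b′ = (a ≡ᵇ a′) ≡ (b ≡ᵇ b′)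

data _≋_ : SetPartition → SetPartition → Set where
  []  : [] ≋ []
  _∷_ : ∀ {a b A B} → Pointwise (SameEquality a b) A B → A ≋ B → (a ∷ A) ≋ (b ∷ B)

≋-length : ∀ {A B} → A ≋ B → length A ≡ length B
≋-length []      = refl
≋-length (_ ∷ s) = cong suc (≋-length s)

module _ {n : ℕ} where

  agreesWith : Fin n → ℕ → Fin n × ℕ → Bool
  agreesWith x a yl = does (does (x Fin.≟ proj₁ yl) ≟𝔹 (a ≡ᵇ proj₂ yl))

  allB-agreesWith-cong : ∀ x a b {A B} → Pointwise (SameEquality a b) A B → ∀ (u : Word n) →
                         allB (agreesWith x a) (zip u A) ≡ allB (agreesWith x b) (zip u B)
  allB-agreesWith-cong x a b []       []      = refl
  allB-agreesWith-cong x a b []       (y ∷ u) = refl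
  allB-agreesWith-cong x a b (r ∷ rs) []      = refl
  allB-agreesWith-cong x a b (r ∷ rs) (y ∷ u) =
    cong₂ _∧_ (cong (λ t → does (does (x Fin.≟ y) ≟𝔹 t)) r) (allB-agreesWith-cong x a b rs u)

  samePattern-cong : ∀ {A B} → A ≋ B → ∀ (u : Word n) → samePattern (zip u A) ≡ samePattern (zip u B)
  samePattern-cong []                  []      = refl
  samePattern-cong []                  (x ∷ u) = refl
  samePattern-cong (r ∷ s)             []      = refl
  samePattern-cong (_∷_ {a} {b} r s)   (x ∷ u) = cong₂ _∧_ (allB-agreesWith-cong x a b r u) (samePattern-cong s u)

  mA-cong : ∀ {A B} → A ≋ B → mA n A ≡ mA n B
  mA-cong {A} {B} s = trans
    (concatMap-cong (λ w → cong (λ b → if b then (1ℚ , w) ∷ [] else []) (samePattern-cong s w))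
                    (allWords n (length A)))
    (cong (λ k → concatMap (λ w → if samePattern (zip w B) then (1ℚ , w) ∷ [] else []) (allWords n k)) (≋-length s))

  samePattern⇒≋ : ∀ (u : Word n) A → length u ≡ length A → samePattern (zip u A) ≡ true → A ≋ map toℕ u
  samePattern⇒≋ []      []      _   _    = []
  samePattern⇒≋ (x ∷ u) (a ∷ A) len same =
    agreement u A (ℕ.suc-injective len) (proj₁ (∧≡true⁻ same))
      ∷ samePattern⇒≋ u A (ℕ.suc-injective len) (proj₂ (∧≡true⁻ same))
    where
    agreement : ∀ (u : Word n) A → length u ≡ length A → allB (agreesWith x a) (zip u A) ≡ true →
                Pointwise (SameEquality a (toℕ x)) A (map toℕ u)
    agreement []      []      _   _     = []
    agreement (y ∷ u) (l ∷ A) len agree =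
      trans (sym (≟𝔹≡true⁻ (proj₁ (∧≡true⁻ agree)))) (sym (toℕ-≡ᵇ x y))
        ∷ agreement u A (ℕ.suc-injective len) (proj₂ (∧≡true⁻ agree))

  mA-pattern : ∀ A → mA n A ≡ [] ⊎ ∃ λ (u : Word n) → length u ≡ length A × mA n A ≡ mA n (map toℕ u)
  mA-pattern A with selected-or-none (λ w → samePattern (zip w A)) (1ℚ ,_) (allWords n (length A))
  ... | inj₁ none            = inj₁ none
  ... | inj₂ (u , u∈ , same) = inj₂ (u , |u|≡|A| , mA-cong (samePattern⇒≋ u A |u|≡|A| same))
    where
    |u|≡|A| : length u ≡ length A
    |u|≡|A| = All.lookup (allWords-length (length A)) u∈

  mA-length : ∀ A → All (λ m → length (proj₂ m) ≡ length A) (mA n A)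
  mA-length A = Allₚ.concat⁺ (Allₚ.map⁺ (All.map (λ {w} → selected w (samePattern (zip w A)))
                                                  (allWords-length (length A))))
    where
    selected : ∀ w b → length w ≡ length A →
               All (λ m → length (proj₂ m) ≡ length A) (if b then (1ℚ , w) ∷ [] else [])
    selected w true  |w|≡|A| = |w|≡|A| ∷ []
    selected w false _       = []

module _ {n : ℕ} where

  InIdeal-isSubspace : IsSubspace (InIdeal {n})
  InIdeal-isSubspace = record
    { zero-closed = [] , [] , λ w → refl
    ; ⊕-closed    = λ {p} {q} → ⊕-closed {p} {q}
    ; ·-closed    = λ a {p} → ·-closed a {p}
    ; ≈-closed    = λ p≈q (gs , gs≢[] , p≈gs) → gs , gs≢[] , λ w → trans (sym (p≈q w)) (p≈gs w)
    }
    where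
    generated : List (NCPoly n × SetPartition) → NCPoly n
    generated gs = concatMap (λ g → proj₁ g ⊛ mA n (proj₂ g)) gs

    ⊕-closed : ∀ {p q} → InIdeal p → InIdeal q → InIdeal (p ⊕ q)
    ⊕-closed {p} {q} (gs , gs≢[] , p≈gs) (hs , hs≢[] , q≈hs) = gs ++ hs , Allₚ.++⁺ gs≢[] hs≢[] , λ w → begin
      coeff (p ⊕ q) w                                 ≡⟨ coeff-⊕ p q w ⟩
      coeff p w + coeff q w                           ≡⟨ cong₂ _+_ (p≈gs w) (q≈hs w) ⟩
      coeff (generated gs) w + coeff (generated hs) w ≡⟨ coeff-⊕ (generated gs) (generated hs) w ⟨
      coeff (generated gs ⊕ generated hs) w           ≡⟨ cong (λ r → coeff r w) (concatMap-++ _ gs hs) ⟨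
      coeff (generated (gs ++ hs)) w                  ∎
      where open ≡-Reasoning

    ·-closed : ∀ a {p} → InIdeal p → InIdeal (a · p)
    ·-closed a {p} (gs , gs≢[] , p≈gs) = a·gs , Allₚ.map⁺ gs≢[] , λ w → begin
      coeff (a · p) w                                       ≡⟨ coeff-· a p w ⟩
      a * coeff p w                                         ≡⟨ cong (a *_) (trans (p≈gs w) (coeff-concatMap _ gs w)) ⟩
      a * ∑[ g ∈ gs ] coeff (proj₁ g ⊛ mA n (proj₂ g)) w    ≡⟨ *-distribˡ-∑ gs a _ ⟩
      ∑[ g ∈ gs ] (a * coeff (proj₁ g ⊛ mA n (proj₂ g)) w)  ≡⟨ ∑-cong gs (λ (P , A) → coeff-⊛-·ˡ a P (mA n A) w) ⟨
      ∑[ g ∈ gs ] coeff ((a · proj₁ g) ⊛ mA n (proj₂ g)) w  ≡⟨ ∑-map _ gs _ ⟨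
      ∑[ g ∈ a·gs ] coeff (proj₁ g ⊛ mA n (proj₂ g)) w      ≡⟨ coeff-concatMap _ a·gs w ⟨
      coeff (generated a·gs) w                              ∎
      where
      open ≡-Reasoning
      a·gs : List (NCPoly n × SetPartition)
      a·gs = map (λ g → a · proj₁ g , proj₂ g) gs

  ⊛mA-InIdeal : ∀ P A → NonEmpty A → InIdeal (P ⊛ mA n A)
  ⊛mA-InIdeal P A A≢[] = (P , A) ∷ [] , A≢[] ∷ [] , ≈-reflexive (sym (++-identityʳ (P ⊛ mA n A)))

  ≈⇒≈I : ∀ {p q : NCPoly n} → p ≈ q → p ≈I q
  ≈⇒≈I {p} {q} p≈q = [] , [] , λ w →
    trans (coeff-⊖ p q w) (trans (cong (λ x → coeff p w - x) (sym (p≈q w))) (ℚ.+-inverseʳ (coeff p w)))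

  ≡⇒≈I : ∀ {p q : NCPoly n} → p ≡ q → p ≈I q
  ≡⇒≈I {p} {q} p≡q = ≈⇒≈I {p} {q} (≈-reflexive p≡q)

  rev : NCPoly n → NCPoly n
  rev p = map (λ m → proj₁ m , reverse (proj₂ m)) p

  ≟w-reverse : ∀ (u w : Word n) → (reverse u ≟w w) ≡ (u ≟w reverse w)
  ≟w-reverse u w = does-⇔ (mk⇔ (λ e → trans (sym (reverse-involutive u)) (cong reverse e))
                                (λ e → trans (cong reverse e) (reverse-involutive w)))
                           (≡-dec Fin._≟_ (reverse u) w) (≡-dec Fin._≟_ u (reverse w))

  coeff-rev : ∀ p w → coeff (rev p) w ≡ coeff p (reverse w)
  coeff-rev []            w = refl
  coeff-rev ((c , u) ∷ p) w = cong₂ _+_ (cong (λ b → if b then c else 0ℚ) (≟w-reverse u w)) (coeff-rev p w)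

  rev-cong : ∀ {p q} → p ≈ q → rev p ≈ rev q
  rev-cong {p} {q} p≈q w = trans (coeff-rev p w) (trans (p≈q (reverse w)) (sym (coeff-rev q w)))

  rev-involutive : ∀ p → rev (rev p) ≡ p
  rev-involutive []            = refl
  rev-involutive ((c , u) ∷ p) = cong₂ _∷_ (cong (c ,_) (reverse-involutive u)) (rev-involutive p)

  rev-· : ∀ a p → rev (a · p) ≡ a · rev p
  rev-· a []      = refl
  rev-· a (m ∷ p) = cong (_ ∷_) (rev-· a p)

  rev-⊕ : ∀ p q → rev (p ⊕ q) ≡ rev p ⊕ rev q
  rev-⊕ = map-++ _

  rev-⊖ : ∀ p q → rev (p ⊖ q) ≡ rev p ⊖ rev q
  rev-⊖ p q = trans (rev-⊕ p _) (cong (rev p ⊕_) (rev-· (- 1ℚ) q))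

  rev-act : ∀ σ p → rev (act σ p) ≡ act σ (rev p)
  rev-act σ []            = refl
  rev-act σ ((c , u) ∷ p) = cong₂ _∷_ (cong (c ,_) (sym (reverse-map (σ ⟨$⟩ʳ_) u))) (rev-act σ p)

  rev-homogeneous : ∀ {d p} → Homogeneous d p → Homogeneous d (rev p)
  rev-homogeneous {p = p} hom w |w|≢d =
    trans (coeff-rev p w) (hom (reverse w) (|w|≢d ∘ trans (sym (length-reverse w))))

  rev⁻¹-isSubspace : ∀ {S} → IsSubspace S → IsSubspace (S ∘ rev)
  rev⁻¹-isSubspace {S} S-sub = record
    { zero-closed = zero-closed
    ; ⊕-closed    = λ {p} {q} Sp Sq → ≈-closed (≈-reflexive (sym (rev-⊕ p q))) (⊕-closed Sp Sq)
    ; ·-closed    = λ a {p} Sp → ≈-closed (≈-reflexive (sym (rev-· a p))) (·-closed a Sp)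
    ; ≈-closed    = λ {p} {q} p≈q → ≈-closed (rev-cong {p} {q} p≈q)
    }
    where open IsSubspace S-sub

  rev-revMul : ∀ f v → rev (revMul f v) ≡ ((1ℚ , reverse v) ∷ []) ⊛ f
  rev-revMul f v = trans (reversed f) (sym (++-identityʳ _))
    where
    reversed : ∀ f → rev (revMul f v) ≡ map (λ m → 1ℚ * proj₁ m , reverse v ++ proj₂ m) f
    reversed []            = refl
    reversed ((c , u) ∷ f) = cong₂ _∷_
      (cong₂ _,_ (sym (ℚ.*-identityˡ c)) (trans (reverse-++ (reverse u) v) (cong (reverse v ++_) (reverse-involutive u))))
      (reversed f)

  pairing-rev : ∀ x Q → pairing (rev x) Q ≡ ∑[ m ∈ x ] (proj₁ m * coeff Q (reverse (proj₂ m)))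
  pairing-rev x Q = ∑-map _ x _

  pairing-rev-⊛ : ∀ P f Q →
    pairing (rev (P ⊛ f)) Q ≡ ∑[ m ∈ P ] (proj₁ m * pairing (revMul f (reverse (proj₂ m))) Q)
  pairing-rev-⊛ P f Q = trans (pairing-rev (P ⊛ f) Q) (trans (∑-concatMap _ P _) (∑-cong P row))
    where
    row : ∀ m → ∑[ x ∈ map (λ m′ → proj₁ m * proj₁ m′ , proj₂ m ++ proj₂ m′) f ]
                  (proj₁ x * coeff Q (reverse (proj₂ x)))
              ≡ proj₁ m * pairing (revMul f (reverse (proj₂ m))) Q
    row (c , u) = begin
      ∑[ x ∈ map (λ m′ → c * proj₁ m′ , u ++ proj₂ m′) f ] (proj₁ x * coeff Q (reverse (proj₂ x)))
        ≡⟨ ∑-map _ f _ ⟩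
      ∑[ m′ ∈ f ] ((c * proj₁ m′) * coeff Q (reverse (u ++ proj₂ m′)))
        ≡⟨ ∑-cong f (λ m′ → trans (ℚ.*-assoc c (proj₁ m′) _)
                                  (cong (λ v → c * (proj₁ m′ * coeff Q v)) (reverse-++ u (proj₂ m′)))) ⟩
      ∑[ m′ ∈ f ] (c * (proj₁ m′ * coeff Q (reverse (proj₂ m′) ++ reverse u)))
        ≡⟨ *-distribˡ-∑ f c _ ⟨
      c * ∑[ m′ ∈ f ] (proj₁ m′ * coeff Q (reverse (proj₂ m′) ++ reverse u))
        ≡⟨ cong (c *_) (pairing-revMul f (reverse u) Q) ⟨
      c * pairing (revMul f (reverse u)) Q
        ∎
      where open ≡-Reasoning

  annihilated⇒pairing-rev-⊛mA : ∀ {Q} → AnnihilatedByNCSym⁺ Q → ∀ P A → NonEmpty A →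
                                pairing (rev (P ⊛ mA n A)) Q ≡ 0ℚ
  annihilated⇒pairing-rev-⊛mA {Q} annihilated P A A≢[] =
    trans (pairing-rev-⊛ P (mA n A) Q) (∑-vanishes (All.universal killed P))
    where
    killed : ∀ m → proj₁ m * pairing (revMul (mA n A) (reverse (proj₂ m))) Q ≡ 0ℚ
    killed (c , u) = trans (cong (c *_) (annihilated A A≢[] (reverse u))) (ℚ.*-zeroʳ c)

  annihilated⇒rev-InIdeal-⟂ : ∀ d Q → Homogeneous d Q → AnnihilatedByNCSym⁺ Q →
                              ∀ X → InIdeal X → InnerProduct.⟨_,_⟩ (allWords n d) (rev X) Q ≡ 0ℚ
  annihilated⇒rev-InIdeal-⟂ d Q hom annihilated X (gs , gs≢[] , X≈gs) = begin
    ⟨ rev X , Q ⟩                                       ≡⟨ ⟨⟩-congˡ Q {rev X} {rev generated} (rev-cong {X} {generated} X≈gs) ⟩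
    ⟨ rev generated , Q ⟩                               ≡⟨ ⟨⟩≡pairing d (rev generated) Q hom ⟩
    pairing (rev generated) Q                           ≡⟨ cong (λ x → pairing x Q) (map-concatMap _ generator gs) ⟩
    pairing (concatMap (rev ∘ generator) gs) Q          ≡⟨ ∑-concatMap (rev ∘ generator) gs _ ⟩
    ∑[ g ∈ gs ] pairing (rev (generator g)) Q           ≡⟨ ∑-vanishes (All.map (λ {(P , A)} →
                                                             annihilated⇒pairing-rev-⊛mA {Q} annihilated P A) gs≢[]) ⟩
    0ℚ                                                  ∎
    where
    open ≡-Reasoning
    open InnerProduct (allWords n d)
    generator : NCPoly n × SetPartition → NCPoly n
    generator g = proj₁ g ⊛ mA n (proj₂ g)
    generated : NCPoly n
    generated = concatMap generator gs

module _ {n : ℕ} where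

  splits : Word n → List (Word n × Word n)
  splits []      = []
  splits (x ∷ w) = (x ∷ [] , w) ∷ map (λ uv → x ∷ proj₁ uv , proj₂ uv) (splits w)

  splits-sound : ∀ w → All (λ uv → ¬ proj₁ uv ≡ [] × proj₁ uv ++ proj₂ uv ≡ w) (splits w)
  splits-sound []      = []
  splits-sound (x ∷ w) =
    ((λ ()) , refl) ∷ Allₚ.map⁺ (All.map (λ (_ , uv≡w) → (λ ()) , cong (x ∷_) uv≡w) (splits-sound w))

  ∈-splits : ∀ u v → ¬ u ≡ [] → (u , v) ∈ splits (u ++ v)
  ∈-splits []          v u≢[] with () ← u≢[] refl
  ∈-splits (x ∷ [])    v _    = here refl
  ∈-splits (x ∷ y ∷ u) v _    = there (∈-map⁺ _ (∈-splits (y ∷ u) v (λ ())))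

  -- Set partitions are unbounded label lists, but by mA-pattern every nonzero m_A equals
  -- m_{map toℕ u} for a word u of the same length, so indexing generators by words loses nothing.
  revIdealGenerator : Word n × Word n → NCPoly n
  revIdealGenerator (u , v) = revMul (mA n (map toℕ u)) v

  revIdealGenerators : ℕ → List (NCPoly n)
  revIdealGenerators d = map revIdealGenerator (concatMap splits (allWords n d))

  All-revIdealGenerators : ∀ {P : NCPoly n → Set} d →
    (∀ u v → ¬ u ≡ [] → length u ℕ.+ length v ≡ d → P (revIdealGenerator (u , v))) → All P (revIdealGenerators d)
  All-revIdealGenerators d P-gen = Allₚ.map⁺ (Allₚ.concat⁺ (Allₚ.map⁺ (All.map (λ {w} |w|≡d →
    All.map (λ {(u , v)} (u≢[] , uv≡w) → P-gen u v u≢[] (trans (sym (length-++ u)) (trans (cong length uv≡w) |w|≡d)))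
            (splits-sound w))
    (allWords-length d))))

  ∈-revIdealGenerators : ∀ d u v → ¬ u ≡ [] → length u ℕ.+ length v ≡ d →
                         revIdealGenerator (u , v) ∈ revIdealGenerators d
  ∈-revIdealGenerators d u v u≢[] |u|+|v|≡d = ∈-map⁺ revIdealGenerator (∈-concatMap⁺ splits
    (Any.map (λ { refl → ∈-splits u v u≢[] })
             (subst (λ k → u ++ v ∈ allWords n k) (trans (length-++ u) |u|+|v|≡d) (∈-allWords (u ++ v)))))

  revIdealGenerators-homogeneous : ∀ d → All (Homogeneous d) (revIdealGenerators d)
  revIdealGenerators-homogeneous d = All-revIdealGenerators d λ u v _ |u|+|v|≡d →
    homogeneous-by-lengths _
      (All.map (λ |m|≡ → trans |m|≡ (trans (cong (ℕ._+ length v) (length-map toℕ u)) |u|+|v|≡d))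
               (revMul-lengths _ v (mA-length (map toℕ u))))

  revIdealGenerators-rev∈ideal : ∀ d → All (InIdeal ∘ rev) (revIdealGenerators d)
  revIdealGenerators-rev∈ideal d = All-revIdealGenerators d λ u v u≢[] _ → rev∈ideal u v u≢[]
    where
    rev∈ideal : ∀ u v → ¬ u ≡ [] → InIdeal (rev (revIdealGenerator (u , v)))
    rev∈ideal []        v u≢[] with () ← u≢[] refl
    rev∈ideal u@(_ ∷ _) v _    =
      IsSubspace.≈-closed InIdeal-isSubspace {((1ℚ , reverse v) ∷ []) ⊛ f} {rev (revMul f v)}
        (≈-reflexive (sym (rev-revMul f v))) (⊛mA-InIdeal ((1ℚ , reverse v) ∷ []) (map toℕ u) λ ())
      where f = mA n (map toℕ u)

-- Harmonics as the orthogonal complement of the reversed ideal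

module _ {n : ℕ} (d : ℕ) where

  open InnerProduct (allWords n d)

  ⟂revIdealGenerators⇒annihilated : ∀ r → Homogeneous d r → r ⟂ revIdealGenerators d → AnnihilatedByNCSym⁺ r
  ⟂revIdealGenerators⇒annihilated r hom r⟂ A A≢[] w with length A ℕ.+ length w ℕ.≟ d | mA-pattern A
  ... | no |A|+|w|≢d | _ =
    pairing-off-degree r (revMul (mA n A) w) hom
      (All.map (λ {m} |m|≡|A|+|w| → |A|+|w|≢d ∘ trans (sym |m|≡|A|+|w|)) (revMul-lengths (mA n A) w (mA-length A)))
  ... | yes _ | inj₁ mA≡[] = cong (λ f → pairing (revMul f w) r) mA≡[]
  ... | yes |A|+|w|≡d | inj₂ (u , |u|≡|A| , mA≡mA[u]) = begin
    pairing (revMul (mA n A) w) r          ≡⟨ cong (λ f → pairing (revMul f w) r) mA≡mA[u] ⟩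
    pairing (revIdealGenerator (u , w)) r  ≡⟨ ⟨⟩≡pairing d (revIdealGenerator (u , w)) r hom ⟨
    ⟨ revIdealGenerator (u , w) , r ⟩      ≡⟨ ⟨⟩-sym (revIdealGenerator (u , w)) r ⟩
    ⟨ r , revIdealGenerator (u , w) ⟩      ≡⟨ All.lookup r⟂ (∈-revIdealGenerators d u w u≢[] |u|+|w|≡d) ⟩
    0ℚ                                     ∎
    where
    open ≡-Reasoning
    u≢[] : ¬ u ≡ []
    u≢[] = ≢[]-by-length u A |u|≡|A| A≢[]
    |u|+|w|≡d : length u ℕ.+ length w ≡ d
    |u|+|w|≡d = trans (cong (ℕ._+ length w) |u|≡|A|) |A|+|w|≡d

  harmonic∧rev∈ideal⇒≈0 : ∀ Q → HarDeg n d Q → InIdeal (rev Q) → Q ≈ zeroP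
  harmonic∧rev∈ideal⇒≈0 Q (hom , harmonic) rev-Q∈ideal w with length w ℕ.≟ d
  ... | no  |w|≢d = hom w |w|≢d
  ... | yes refl  = All.lookup (isotropic⇒vanishes Q ⟨Q,Q⟩≡0) (∈-allWords w)
    where
    ⟨Q,Q⟩≡0 : ⟨ Q , Q ⟩ ≡ 0ℚ
    ⟨Q,Q⟩≡0 = trans (cong ⟨_, Q ⟩ (sym (rev-involutive Q)))
                    (annihilated⇒rev-InIdeal-⟂ d Q hom (NCHar⇒annihilated harmonic) (rev Q) rev-Q∈ideal)

  harmonic-representative : ∀ P → Homogeneous d P → ∃ λ Q → HarDeg n d Q × (P ≈I rev Q)
  harmonic-representative P hom-P with orthogonal-decomposition (revIdealGenerators d) (rev P)
  ... | r , revP⊖r∈span , r⟂ =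
    r , (hom-r , annihilated⇒NCHar (⟂revIdealGenerators⇒annihilated r hom-r r⟂)) , P⊖rev-r∈ideal
    where
    hom-revP⊖r : Homogeneous d (rev P ⊖ r)
    hom-revP⊖r = Span-least {S = Homogeneous d} (Homogeneous-isSubspace d) (revIdealGenerators-homogeneous d) revP⊖r∈span

    hom-r : Homogeneous d r
    hom-r = IsSubspace.≈-closed (Homogeneous-isSubspace d) {rev P ⊖ (rev P ⊖ r)} {r} (p⊖[p⊖q]≈q (rev P) r)
              (IsSubspace.⊖-closed (Homogeneous-isSubspace d) {rev P} {rev P ⊖ r}
                                   (rev-homogeneous {p = P} hom-P) hom-revP⊖r)

    P⊖rev-r∈ideal : InIdeal (P ⊖ rev r)
    P⊖rev-r∈ideal = IsSubspace.≈-closed InIdeal-isSubspace {rev (rev P ⊖ r)} {P ⊖ rev r}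
      (≈-reflexive (trans (rev-⊖ (rev P) r) (cong (_⊖ rev r) (rev-involutive P))))
      (Span-least {S = InIdeal ∘ rev} (rev⁻¹-isSubspace InIdeal-isSubspace)
                  (revIdealGenerators-rev∈ideal d) revP⊖r∈span)

mainTheorem9 : ∀ (n : ℕ) → GradedIso n
mainTheorem9 n d = record
  { φ            = rev
  ; φ-hom        = λ Q (hom , _) → rev-homogeneous {p = Q} hom
  ; φ-cong       = λ Q Q′ _ _ Q≈Q′ → ≈⇒≈I {p = rev Q} {rev Q′} (rev-cong {p = Q} {Q′} Q≈Q′)
  ; φ-linear     = λ a b Q Q′ _ _ → ≡⇒≈I (rev-linear a b Q Q′)
  ; φ-equivar    = λ σ Q _ → ≡⇒≈I (rev-act σ Q)
  ; φ-injective  = harmonic∧rev∈ideal⇒≈0 d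
  ; φ-surjective = harmonic-representative d
  }
  where
  rev-linear : ∀ a b (Q Q′ : NCPoly n) → rev ((a · Q) ⊕ (b · Q′)) ≡ (a · rev Q) ⊕ (b · rev Q′)
  rev-linear a b Q Q′ = trans (rev-⊕ (a · Q) (b · Q′)) (cong₂ _⊕_ (rev-· a Q) (rev-· b Q′))
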